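{- Let $k\geq 16$ or $k\in\{12,13\}$. Then the set of odd positive integers $n$ with $s_2(n^2)=s_2(n)=k$ is infinite.
   Context: $s_2(m)$ denotes the sum of the binary digits of the nonnegative integer $m$. -}

module Defs where

open import Data.Nat using (ℕ; zero; suc; _+_; _*_; _%_; _/_; _≤_)
open import Data.Product using (Σ; _×_)
open import Relation.Binary.PropositionalEquality using (_≡_)

-- binary digit sum with fuel; fuel m suffices for the input m
s₂-aux : ℕ → ℕ → ℕ
s₂-aux zero    m = 0
s₂-aux (suc f) m = m % 2 + s₂-aux f (m / 2)

s₂ : ℕ → ℕ
s₂ m = s₂-aux m m

Odd : ℕ → Set
Odd n = n % 2 ≡ 1

Infinite : (ℕ → Set) → Set
Infinite P = (N : ℕ) → Σ ℕ (λ n → N ≤ n × P n)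

module Submission where

-- If y is odd, x > 0 and 2^m exceeds y² and 2xy, then for
-- n = y + 2^m·x the binary expansions of n and of
--   n² = y² + 2^m·(2xy + 2^m·x²)
-- are concatenations of the expansions of their summands, so
--   s₂(n) = s₂(y) + s₂(x)   and   s₂(n²) = s₂(y²) + s₂(xy) + s₂(x²).
-- Letting m grow, one "balanced" pair (x, y) with s₂(y²)+s₂(xy)+s₂(x²) =
-- s₂(y)+s₂(x) = k yields infinitely many solutions with digit sum k.
-- Balanced pairs are given by run-length patterns whose run lengths are
-- affine in a parameter i: one family for each residue of k mod 3 covers
-- k ≥ 16 up to five sporadic values, each given by a single pair.  The
-- value of a pattern is a polynomial with natural coefficients in
-- ones i = 2^i − 1, so the identities X² = X·X, Y² = Y·Y, XY = X·Y needed
-- for all i are certified by normalising polynomials, while digit sums of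
-- patterns are read off as the (affine in i) number of ones.

open import Defs
open import Data.Nat using (ℕ; zero; suc; _+_; _*_; _∸_; _^_; _≤_; _<_; z≤n; s≤s; _%_; _/_)
open import Data.Nat.Properties
open import Data.Nat.DivMod
open import Data.Nat.Tactic.RingSolver using (solve-∀)
open import Data.List using (List; []; _∷_)
open import Data.Product using (_×_; _,_)
open import Data.Sum using (_⊎_; inj₁; inj₂)
open import Data.Unit using (⊤; tt)
open import Data.Empty using (⊥)
open import Relation.Binary.PropositionalEquality
open ≡-Reasoning

-- Digit sums

s₂-aux-zero : ∀ f → s₂-aux f 0 ≡ 0
s₂-aux-zero zero    = refl
s₂-aux-zero (suc f) = s₂-aux-zero f

-- Halving strictly decreases a positive number, so fuel m stays sufficient.
half-≤ : ∀ m → suc m / 2 ≤ m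
half-≤ m = ≤-pred (m/n<m (suc m) 2 (s≤s (s≤s z≤n)))

s₂-aux-fuel : ∀ f g m → m ≤ f → m ≤ g → s₂-aux f m ≡ s₂-aux g m
s₂-aux-fuel f g zero _ _ = trans (s₂-aux-zero f) (sym (s₂-aux-zero g))
s₂-aux-fuel (suc f) (suc g) (suc m) (s≤s m≤f) (s≤s m≤g) =
  cong (suc m % 2 +_)
    (s₂-aux-fuel f g (suc m / 2) (≤-trans (half-≤ m) m≤f) (≤-trans (half-≤ m) m≤g))

s₂-step : ∀ m → s₂ m ≡ m % 2 + s₂ (m / 2)
s₂-step zero    = refl
s₂-step (suc m) = cong (suc m % 2 +_) (s₂-aux-fuel m (suc m / 2) (suc m / 2) (half-≤ m) ≤-refl)

last-digit-even : ∀ b a → (b + a * 2) % 2 ≡ b % 2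
last-digit-even b a = [m+kn]%n≡m%n b a 2

halve-even : ∀ b a → (b + a * 2) / 2 ≡ b / 2 + a
halve-even b a = trans (+-distrib-/ b (a * 2) digits<2) (cong (b / 2 +_) (m*n/n≡m a 2))
  where
  digits<2 : b % 2 + (a * 2) % 2 < 2
  digits<2 = subst (λ t → b % 2 + t < 2) (sym (m*n%n≡0 a 2))
               (subst (_< 2) (sym (+-identityʳ (b % 2))) (m%n<n b 2))

double-shift : ∀ p a → 2 * p * a ≡ p * a * 2
double-shift = solve-∀

s₂-concat : ∀ l a b → b < 2 ^ l → s₂ (b + 2 ^ l * a) ≡ s₂ b + s₂ a
s₂-concat zero    a zero    _ = cong s₂ (+-identityʳ a)
s₂-concat zero    a (suc b) (s≤s ())
s₂-concat (suc l) a b b<2^l+1 = begin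
    s₂ (b + 2 ^ suc l * a)
  ≡⟨ cong (λ t → s₂ (b + t)) (double-shift (2 ^ l) a) ⟩
    s₂ (b + 2 ^ l * a * 2)
  ≡⟨ s₂-step (b + 2 ^ l * a * 2) ⟩
    (b + 2 ^ l * a * 2) % 2 + s₂ ((b + 2 ^ l * a * 2) / 2)
  ≡⟨ cong₂ (λ u v → u + s₂ v) (last-digit-even b (2 ^ l * a)) (halve-even b (2 ^ l * a)) ⟩
    b % 2 + s₂ (b / 2 + 2 ^ l * a)
  ≡⟨ cong (b % 2 +_) (s₂-concat l a (b / 2) b/2<2^l) ⟩
    b % 2 + (s₂ (b / 2) + s₂ a)
  ≡⟨ sym (+-assoc (b % 2) _ _) ⟩
    b % 2 + s₂ (b / 2) + s₂ a
  ≡⟨ cong (_+ s₂ a) (sym (s₂-step b)) ⟩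
    s₂ b + s₂ a
  ∎
  where
  b/2<2^l : b / 2 < 2 ^ l
  b/2<2^l = m<n*o⇒m/o<n (subst (b <_) (*-comm 2 (2 ^ l)) b<2^l+1)

s₂-double : ∀ z → s₂ (2 * z) ≡ s₂ z
s₂-double z = s₂-concat 1 z 0 (s≤s z≤n)

n<2^n : ∀ n → n < 2 ^ n
n<2^n zero    = s≤s z≤n
n<2^n (suc n) = +-mono-≤ (m^n>0 2 n) (≤-trans (n<2^n n) (m≤m+n (2 ^ n) 0))

-- The splicing lemma

Solutions : ℕ → ℕ → Set
Solutions k n = 0 < n × Odd n × s₂ (n * n) ≡ k × s₂ n ≡ k

square-split : ∀ y M x → (y + M * x) * (y + M * x) ≡ y * y + M * (2 * (x * y) + M * (x * x))
square-split = solve-∀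

splice : ∀ {k} x y → 0 < x → Odd y →
  s₂ (y * y) + (s₂ (x * y) + s₂ (x * x)) ≡ k → s₂ y + s₂ x ≡ k → Infinite (Solutions k)
splice {k} x@(suc _) y@(suc _) _ y-odd square-digits digits N =
  n , N≤n , s≤s z≤n , n-odd , n²-weight , n-weight
  where
  -- the shift m = m′ + 1 is positive and exceeds N, y² and 2xy
  m′ = N + (y * y + 2 * (x * y))
  M  = 2 ^ suc m′
  n  = y + M * x

  below-M : ∀ a → a ≤ m′ → a < M
  below-M a a≤m′ = <-trans (s≤s a≤m′) (n<2^n (suc m′))

  y²<M : y * y < M
  y²<M = below-M (y * y) (≤-trans (m≤m+n (y * y) _) (m≤n+m _ N))

  2xy<M : 2 * (x * y) < M
  2xy<M = below-M (2 * (x * y)) (≤-trans (m≤n+m (2 * (x * y)) (y * y)) (m≤n+m _ N))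

  y<M : y < M
  y<M = ≤-<-trans (m≤m*n y y) y²<M

  N≤n : N ≤ n
  N≤n = ≤-trans (<⇒≤ (below-M N (m≤m+n N _))) (≤-trans (m≤m*n M x) (m≤n+m (M * x) y))

  n-odd : Odd n
  n-odd = trans (cong (λ t → (y + t) % 2) (double-shift (2 ^ m′) x))
                (trans (last-digit-even y (2 ^ m′ * x)) y-odd)

  n-weight : s₂ n ≡ k
  n-weight = trans (s₂-concat (suc m′) x y y<M) digits

  n²-weight : s₂ (n * n) ≡ k
  n²-weight = begin
      s₂ (n * n)
    ≡⟨ cong s₂ (square-split y M x) ⟩
      s₂ (y * y + M * (2 * (x * y) + M * (x * x)))
    ≡⟨ s₂-concat (suc m′) _ (y * y) y²<M ⟩
      s₂ (y * y) + s₂ (2 * (x * y) + M * (x * x))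
    ≡⟨ cong (s₂ (y * y) +_) (s₂-concat (suc m′) (x * x) (2 * (x * y)) 2xy<M) ⟩
      s₂ (y * y) + (s₂ (2 * (x * y)) + s₂ (x * x))
    ≡⟨ cong (λ t → s₂ (y * y) + (t + s₂ (x * x))) (s₂-double (x * y)) ⟩
      s₂ (y * y) + (s₂ (x * y) + s₂ (x * x))
    ≡⟨ square-digits ⟩
      k
    ∎

-- Run-length patterns

-- ones L = 2^L − 1, the number written with L ones.
ones : ℕ → ℕ
ones zero    = 0
ones (suc L) = 1 + 2 * ones L

ones-+1 : ∀ L → ones L + 1 ≡ 2 ^ L
ones-+1 zero    = refl
ones-+1 (suc L) = trans (rearrange (ones L)) (cong (2 *_) (ones-+1 L))
  where
  rearrange : ∀ v → 1 + 2 * v + 1 ≡ 2 * (v + 1)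
  rearrange = solve-∀

ones<2^ : ∀ L → ones L < 2 ^ L
ones<2^ L = subst (ones L <_) (ones-+1 L) (subst (_≤ ones L + 1) (+-comm (ones L) 1) ≤-refl)

s₂-ones : ∀ L → s₂ (ones L) ≡ L
s₂-ones zero    = refl
s₂-ones (suc L) = trans (s₂-concat 1 (ones L) 1 (s≤s (s≤s z≤n))) (cong suc (s₂-ones L))

ones-+ : ∀ a b → ones (a + b) ≡ ones a + 2 ^ a * ones b
ones-+ zero    b = sym (+-identityʳ (ones b))
ones-+ (suc a) b = trans (cong (λ t → 1 + 2 * t) (ones-+ a b)) (regroup (ones a) (2 ^ a) (ones b))
  where
  regroup : ∀ u p v → 1 + 2 * (u + p * v) ≡ 1 + 2 * u + 2 * p * v
  regroup = solve-∀

-- A run of ones (I) or zeros (O) of length c + e·i, for a parameter i.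
data Run : Set where
  I O : ℕ → ℕ → Run

Pattern : Set
Pattern = List Run

runLength : Run → ℕ → ℕ
runLength (I c e) i = c + e * i
runLength (O c e) i = c + e * i

runValue : Run → ℕ → ℕ
runValue (I c e) i = ones (c + e * i)
runValue (O c e) i = 0

-- The number whose binary expansion, least significant digit first, is
-- the pattern instantiated at i.
value : Pattern → ℕ → ℕ
value []      i = 0
value (ρ ∷ p) i = runValue ρ i + 2 ^ runLength ρ i * value p i

constant : Pattern → ℕ
constant []          = 0
constant (I c e ∷ p) = c + constant p
constant (O c e ∷ p) = constant p

slope : Pattern → ℕ
slope []          = 0
slope (I c e ∷ p) = e + slope p
slope (O c e ∷ p) = slope p

weight : Pattern → ℕ → ℕ
weight p i = constant p + slope p * i

-- A run fits into its length, so runs concatenate digit-wise.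
runValue<2^ : ∀ ρ i → runValue ρ i < 2 ^ runLength ρ i
runValue<2^ (I c e) i = ones<2^ (c + e * i)
runValue<2^ (O c e) i = m^n>0 2 (c + e * i)

s₂-value : ∀ p i → s₂ (value p i) ≡ weight p i
s₂-value []      i = refl
s₂-value (ρ ∷ p) i = trans (s₂-concat (runLength ρ i) (value p i) (runValue ρ i) (runValue<2^ ρ i))
                           (run-weight ρ)
  where
  run-weight : ∀ ρ → s₂ (runValue ρ i) + s₂ (value p i) ≡ weight (ρ ∷ p) i
  run-weight (I c e) = trans (cong₂ _+_ (s₂-ones (c + e * i)) (s₂-value p i))
                             (regroup c e i (constant p) (slope p))
    where
    regroup : ∀ c e i a b → c + e * i + (a + b * i) ≡ c + a + (e + b) * i
    regroup = solve-∀
  run-weight (O c e) = s₂-value p i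

StartsWithOne : Pattern → Set
StartsWithOne (I (suc c) e ∷ p) = ⊤
StartsWithOne _                 = ⊥

startsWithOne-odd : ∀ p i → StartsWithOne p → Odd (value p i)
startsWithOne-odd (I (suc c) e ∷ p) i _ =
  trans (cong (_% 2) (odd-form (ones L) (2 ^ L) (value p i))) (last-digit-even 1 (ones L + 2 ^ L * value p i))
  where
  L = c + e * i
  odd-form : ∀ u q v → 1 + 2 * u + 2 * q * v ≡ 1 + (u + q * v) * 2
  odd-form = solve-∀

-- Polynomials with natural coefficients, constant term first

Poly : Set
Poly = List ℕ

eval : Poly → ℕ → ℕ
eval []      x = 0
eval (a ∷ p) x = a + x * eval p x

infixl 6 _⊕_
infixl 7 _⊗_

_⊕_ : Poly → Poly → Poly
[]      ⊕ q       = q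
(a ∷ p) ⊕ []      = a ∷ p
(a ∷ p) ⊕ (b ∷ q) = a + b ∷ p ⊕ q

scale : ℕ → Poly → Poly
scale k []      = []
scale k (a ∷ p) = k * a ∷ scale k p

_⊗_ : Poly → Poly → Poly
[]      ⊗ q = []
(a ∷ p) ⊗ q = scale a q ⊕ (0 ∷ p ⊗ q)

eval-⊕ : ∀ p q x → eval (p ⊕ q) x ≡ eval p x + eval q x
eval-⊕ []      q       x = refl
eval-⊕ (a ∷ p) []      x = sym (+-identityʳ _)
eval-⊕ (a ∷ p) (b ∷ q) x rewrite eval-⊕ p q x = interchange a b x (eval p x) (eval q x)
  where
  interchange : ∀ a b x u v → a + b + x * (u + v) ≡ a + x * u + (b + x * v)
  interchange = solve-∀

eval-scale : ∀ k p x → eval (scale k p) x ≡ k * eval p x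
eval-scale k []      x = sym (*-zeroʳ k)
eval-scale k (a ∷ p) x rewrite eval-scale k p x = distribute k a x (eval p x)
  where
  distribute : ∀ k a x u → k * a + x * (k * u) ≡ k * (a + x * u)
  distribute = solve-∀

eval-⊗ : ∀ p q x → eval (p ⊗ q) x ≡ eval p x * eval q x
eval-⊗ []      q x = refl
eval-⊗ (a ∷ p) q x
  rewrite eval-⊕ (scale a q) (0 ∷ p ⊗ q) x | eval-scale a q x | eval-⊗ p q x
  = distribute a x (eval p x) (eval q x)
  where
  distribute : ∀ a x u v → a * v + x * (u * v) ≡ (a + x * u) * v
  distribute = solve-∀

-- Normal forms: trailing zero coefficients removed, so that equal
-- polynomials have equal normal forms.
cons₀ : ℕ → Poly → Poly
cons₀ zero [] = []
cons₀ a    q  = a ∷ q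

eval-cons₀ : ∀ a q x → eval (cons₀ a q) x ≡ eval (a ∷ q) x
eval-cons₀ zero    []      x = sym (*-zeroʳ x)
eval-cons₀ zero    (b ∷ q) x = refl
eval-cons₀ (suc a) q       x = refl

normalize : Poly → Poly
normalize []      = []
normalize (a ∷ p) = cons₀ a (normalize p)

eval-normalize : ∀ p x → eval (normalize p) x ≡ eval p x
eval-normalize []      x = refl
eval-normalize (a ∷ p) x = trans (eval-cons₀ a (normalize p) x) (cong (λ t → a + x * t) (eval-normalize p x))

-- Patterns as polynomials in R = ones i, using 2^i = 1 + R

2^≡1+ones : ∀ i → 2 ^ i ≡ 1 + ones i
2^≡1+ones i = trans (sym (ones-+1 i)) (+-comm (ones i) 1)

1+X : Poly
1+X = 1 ∷ 1 ∷ []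

eval-1+X : ∀ x → eval 1+X x ≡ 1 + x
eval-1+X x = simplify x
  where
  simplify : ∀ x → 1 + x * (1 + x * 0) ≡ 1 + x
  simplify = solve-∀

powerP : ℕ → Poly
powerP zero    = 1 ∷ []
powerP (suc e) = 1+X ⊗ powerP e

eval-powerP : ∀ e i → eval (powerP e) (ones i) ≡ 2 ^ (e * i)
eval-powerP zero    i = cong (1 +_) (*-zeroʳ (ones i))
eval-powerP (suc e) i = begin
    eval (1+X ⊗ powerP e) (ones i)
  ≡⟨ eval-⊗ 1+X (powerP e) (ones i) ⟩
    eval 1+X (ones i) * eval (powerP e) (ones i)
  ≡⟨ cong₂ _*_ (trans (eval-1+X (ones i)) (sym (2^≡1+ones i))) (eval-powerP e i) ⟩
    2 ^ i * 2 ^ (e * i)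
  ≡⟨ sym (^-distribˡ-+-* 2 i (e * i)) ⟩
    2 ^ (i + e * i)
  ∎

-- onesP e represents ones (e·i) = R + (1 + R)·ones ((e − 1)·i).
onesP : ℕ → Poly
onesP zero    = []
onesP (suc e) = (0 ∷ 1 ∷ []) ⊕ 1+X ⊗ onesP e

eval-onesP : ∀ e i → eval (onesP e) (ones i) ≡ ones (e * i)
eval-onesP zero    i = refl
eval-onesP (suc e) i = begin
    eval ((0 ∷ 1 ∷ []) ⊕ 1+X ⊗ onesP e) R
  ≡⟨ eval-⊕ (0 ∷ 1 ∷ []) (1+X ⊗ onesP e) R ⟩
    eval (0 ∷ 1 ∷ []) R + eval (1+X ⊗ onesP e) R
  ≡⟨ cong (eval (0 ∷ 1 ∷ []) R +_) (eval-⊗ 1+X (onesP e) R) ⟩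
    eval (0 ∷ 1 ∷ []) R + eval 1+X R * eval (onesP e) R
  ≡⟨ simplify R (eval (onesP e) R) ⟩
    R + (1 + R) * eval (onesP e) R
  ≡⟨ cong₂ (λ u v → R + u * v) (sym (2^≡1+ones i)) (eval-onesP e i) ⟩
    R + 2 ^ i * ones (e * i)
  ≡⟨ sym (ones-+ i (e * i)) ⟩
    ones (i + e * i)
  ∎
  where
  R = ones i
  simplify : ∀ r v → (0 + r * (1 + r * 0)) + (1 + r * (1 + r * 0)) * v ≡ r + (1 + r) * v
  simplify = solve-∀

shiftP : ℕ → ℕ → Poly
shiftP c e = scale (2 ^ c) (powerP e)

eval-shiftP : ∀ c e i → eval (shiftP c e) (ones i) ≡ 2 ^ (c + e * i)
eval-shiftP c e i = begin
    eval (scale (2 ^ c) (powerP e)) (ones i)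
  ≡⟨ eval-scale (2 ^ c) (powerP e) (ones i) ⟩
    2 ^ c * eval (powerP e) (ones i)
  ≡⟨ cong (2 ^ c *_) (eval-powerP e i) ⟩
    2 ^ c * 2 ^ (e * i)
  ≡⟨ sym (^-distribˡ-+-* 2 c (e * i)) ⟩
    2 ^ (c + e * i)
  ∎

runValueP : Run → Poly
runValueP (I c e) = (ones c ∷ []) ⊕ scale (2 ^ c) (onesP e)
runValueP (O c e) = []

runPowerP : Run → Poly
runPowerP (I c e) = shiftP c e
runPowerP (O c e) = shiftP c e

eval-runValueP : ∀ ρ i → eval (runValueP ρ) (ones i) ≡ runValue ρ i
eval-runValueP (O c e) i = refl
eval-runValueP (I c e) i = begin
    eval ((ones c ∷ []) ⊕ scale (2 ^ c) (onesP e)) R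
  ≡⟨ eval-⊕ (ones c ∷ []) (scale (2 ^ c) (onesP e)) R ⟩
    eval (ones c ∷ []) R + eval (scale (2 ^ c) (onesP e)) R
  ≡⟨ cong₂ _+_ (trans (cong (ones c +_) (*-zeroʳ R)) (+-identityʳ (ones c)))
               (eval-scale (2 ^ c) (onesP e) R) ⟩
    ones c + 2 ^ c * eval (onesP e) R
  ≡⟨ cong (λ t → ones c + 2 ^ c * t) (eval-onesP e i) ⟩
    ones c + 2 ^ c * ones (e * i)
  ≡⟨ sym (ones-+ c (e * i)) ⟩
    ones (c + e * i)
  ∎
  where R = ones i

eval-runPowerP : ∀ ρ i → eval (runPowerP ρ) (ones i) ≡ 2 ^ runLength ρ i
eval-runPowerP (I c e) i = eval-shiftP c e i
eval-runPowerP (O c e) i = eval-shiftP c e i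

patternP : Pattern → Poly
patternP []      = []
patternP (ρ ∷ p) = runValueP ρ ⊕ runPowerP ρ ⊗ patternP p

eval-patternP : ∀ p i → eval (patternP p) (ones i) ≡ value p i
eval-patternP []      i = refl
eval-patternP (ρ ∷ p) i = begin
    eval (runValueP ρ ⊕ runPowerP ρ ⊗ patternP p) R
  ≡⟨ eval-⊕ (runValueP ρ) (runPowerP ρ ⊗ patternP p) R ⟩
    eval (runValueP ρ) R + eval (runPowerP ρ ⊗ patternP p) R
  ≡⟨ cong (eval (runValueP ρ) R +_) (eval-⊗ (runPowerP ρ) (patternP p) R) ⟩
    eval (runValueP ρ) R + eval (runPowerP ρ) R * eval (patternP p) R
  ≡⟨ cong₂ _+_ (eval-runValueP ρ i) (cong₂ _*_ (eval-runPowerP ρ i) (eval-patternP p i)) ⟩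
    runValue ρ i + 2 ^ runLength ρ i * value p i
  ∎
  where R = ones i

ProductOf : Pattern → Pattern → Pattern → Set
ProductOf P Q PQ = normalize (patternP PQ) ≡ normalize (patternP P ⊗ patternP Q)

value-product : ∀ P Q PQ → ProductOf P Q PQ → ∀ i → value PQ i ≡ value P i * value Q i
value-product P Q PQ certificate i = begin
    value PQ i
  ≡⟨ sym (eval-patternP PQ i) ⟩
    eval (patternP PQ) R
  ≡⟨ sym (eval-normalize (patternP PQ) R) ⟩
    eval (normalize (patternP PQ)) R
  ≡⟨ cong (λ t → eval t R) certificate ⟩
    eval (normalize (patternP P ⊗ patternP Q)) R
  ≡⟨ eval-normalize (patternP P ⊗ patternP Q) R ⟩
    eval (patternP P ⊗ patternP Q) R
  ≡⟨ eval-⊗ (patternP P) (patternP Q) R ⟩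
    eval (patternP P) R * eval (patternP Q) R
  ≡⟨ cong₂ _*_ (eval-patternP P i) (eval-patternP Q i) ⟩
    value P i * value Q i
  ∎
  where R = ones i

-- Balanced families

record BalancedFamily : Set where
  field
    X Y X² Y² XY : Pattern
    X-starts : StartsWithOne X
    Y-starts : StartsWithOne Y
    X²-product : ProductOf X X X²
    Y²-product : ProductOf Y Y Y²
    XY-product : ProductOf X Y XY
    constant-balanced : constant Y² + (constant XY + constant X²) ≡ constant Y + constant X
    slope-balanced : slope Y² + (slope XY + slope X²) ≡ slope Y + slope X

odd⇒positive : ∀ {n} → Odd n → 0 < n
odd⇒positive {suc n} _ = s≤s z≤n

s₂-product : ∀ P Q PQ → ProductOf P Q PQ → ∀ i → s₂ (value P i * value Q i) ≡ weight PQ i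
s₂-product P Q PQ certificate i =
  trans (cong s₂ (sym (value-product P Q PQ certificate i))) (s₂-value PQ i)

family-solutions : ∀ (F : BalancedFamily) i → let open BalancedFamily F in
  Infinite (Solutions (constant Y + constant X + (slope Y + slope X) * i))
family-solutions F i =
  splice x y (odd⇒positive (startsWithOne-odd X i X-starts)) (startsWithOne-odd Y i Y-starts)
    square-weight base-weight
  where
  open BalancedFamily F
  x = value X i
  y = value Y i

  collect₃ : ∀ a b c d e f i → a + d * i + (b + e * i + (c + f * i)) ≡ a + (b + c) + (d + (e + f)) * i
  collect₃ = solve-∀

  collect₂ : ∀ a b c d i → a + c * i + (b + d * i) ≡ a + b + (c + d) * i
  collect₂ = solve-∀

  square-weight : s₂ (y * y) + (s₂ (x * y) + s₂ (x * x))
                ≡ constant Y + constant X + (slope Y + slope X) * i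
  square-weight = begin
      s₂ (y * y) + (s₂ (x * y) + s₂ (x * x))
    ≡⟨ cong₂ _+_ (s₂-product Y Y Y² Y²-product i)
                 (cong₂ _+_ (s₂-product X Y XY XY-product i) (s₂-product X X X² X²-product i)) ⟩
      weight Y² i + (weight XY i + weight X² i)
    ≡⟨ collect₃ (constant Y²) (constant XY) (constant X²) (slope Y²) (slope XY) (slope X²) i ⟩
      constant Y² + (constant XY + constant X²) + (slope Y² + (slope XY + slope X²)) * i
    ≡⟨ cong₂ (λ a b → a + b * i) constant-balanced slope-balanced ⟩
      constant Y + constant X + (slope Y + slope X) * i
    ∎

  base-weight : s₂ y + s₂ x ≡ constant Y + constant X + (slope Y + slope X) * i
  base-weight = trans (cong₂ _+_ (s₂-value Y i) (s₂-value X i))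
                      (collect₂ (constant Y) (constant X) (slope Y) (slope X) i)

-- Digit sum 16 + 3i.
family₀ : BalancedFamily
family₀ = record
  { X  = I 7 1 ∷ O 1 0 ∷ I 3 1 ∷ []
  ; Y  = I 4 1 ∷ O 1 0 ∷ I 2 0 ∷ []
  ; X² = I 1 0 ∷ O 7 1 ∷ I 1 0 ∷ O 3 1 ∷ I 2 0 ∷ O 5 1 ∷ I 3 1 ∷ []
  ; Y² = I 1 0 ∷ O 4 1 ∷ I 1 0 ∷ O 2 0 ∷ I 0 1 ∷ O 4 0 ∷ I 2 0 ∷ []
  ; XY = I 1 0 ∷ O 3 1 ∷ I 1 0 ∷ O 9 1 ∷ I 1 1 ∷ O 1 0 ∷ I 2 0 ∷ []
  ; X-starts = tt ; Y-starts = tt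
  ; X²-product = refl ; Y²-product = refl ; XY-product = refl
  ; constant-balanced = refl ; slope-balanced = refl
  }

-- Digit sum 20 + 3i.
family₁ : BalancedFamily
family₁ = record
  { X  = I 9 1 ∷ O 1 0 ∷ I 3 1 ∷ []
  ; Y  = I 5 1 ∷ O 1 0 ∷ I 3 0 ∷ []
  ; X² = I 1 0 ∷ O 9 1 ∷ I 1 0 ∷ O 3 1 ∷ I 4 0 ∷ O 5 1 ∷ I 3 1 ∷ []
  ; Y² = I 1 0 ∷ O 5 1 ∷ I 1 0 ∷ O 3 0 ∷ I 0 1 ∷ O 5 0 ∷ I 3 0 ∷ []
  ; XY = I 1 0 ∷ O 4 1 ∷ I 1 0 ∷ O 7 1 ∷ I 1 0 ∷ O 4 0 ∷ I 0 1 ∷ O 1 0 ∷ I 3 0 ∷ []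
  ; X-starts = tt ; Y-starts = tt
  ; X²-product = refl ; Y²-product = refl ; XY-product = refl
  ; constant-balanced = refl ; slope-balanced = refl
  }

-- Digit sum 24 + 3i.
family₂ : BalancedFamily
family₂ = record
  { X  = I 9 1 ∷ O 1 0 ∷ I 7 1 ∷ []
  ; Y  = I 5 1 ∷ O 1 0 ∷ I 3 0 ∷ []
  ; X² = I 1 0 ∷ O 9 1 ∷ I 1 0 ∷ O 16 2 ∷ I 7 1 ∷ []
  ; Y² = I 1 0 ∷ O 5 1 ∷ I 1 0 ∷ O 3 0 ∷ I 0 1 ∷ O 5 0 ∷ I 3 0 ∷ []
  ; XY = I 1 0 ∷ O 4 1 ∷ I 1 0 ∷ O 8 1 ∷ I 1 0 ∷ O 2 0 ∷ I 1 0 ∷ O 1 0 ∷ I 3 1 ∷ O 1 0 ∷ I 3 0 ∷ []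
  ; X-starts = tt ; Y-starts = tt
  ; X²-product = refl ; Y²-product = refl ; XY-product = refl
  ; constant-balanced = refl ; slope-balanced = refl
  }

pair₁₂ : BalancedFamily
pair₁₂ = record
  { X  = I 4 0 ∷ O 1 0 ∷ I 2 0 ∷ []
  ; Y  = I 4 0 ∷ O 1 0 ∷ I 2 0 ∷ []
  ; X² = I 1 0 ∷ O 4 0 ∷ I 1 0 ∷ O 6 0 ∷ I 2 0 ∷ []
  ; Y² = I 1 0 ∷ O 4 0 ∷ I 1 0 ∷ O 6 0 ∷ I 2 0 ∷ []
  ; XY = I 1 0 ∷ O 4 0 ∷ I 1 0 ∷ O 6 0 ∷ I 2 0 ∷ []
  ; X-starts = tt ; Y-starts = tt
  ; X²-product = refl ; Y²-product = refl ; XY-product = refl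
  ; constant-balanced = refl ; slope-balanced = refl
  }

pair₁₃ : BalancedFamily
pair₁₃ = record
  { X  = I 6 0 ∷ O 1 0 ∷ I 2 0 ∷ O 1 0 ∷ I 1 0 ∷ []
  ; Y  = I 3 0 ∷ O 1 0 ∷ I 1 0 ∷ []
  ; X² = I 1 0 ∷ O 6 0 ∷ I 1 0 ∷ O 2 0 ∷ I 1 0 ∷ O 5 0 ∷ I 1 0 ∷ O 4 0 ∷ I 1 0 ∷ []
  ; Y² = I 1 0 ∷ O 3 0 ∷ I 1 0 ∷ O 4 0 ∷ I 1 0 ∷ []
  ; XY = I 1 0 ∷ O 2 0 ∷ I 1 0 ∷ O 1 0 ∷ I 1 0 ∷ O 4 0 ∷ I 1 0 ∷ O 4 0 ∷ I 1 0 ∷ []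
  ; X-starts = tt ; Y-starts = tt
  ; X²-product = refl ; Y²-product = refl ; XY-product = refl
  ; constant-balanced = refl ; slope-balanced = refl
  }

pair₁₇ : BalancedFamily
pair₁₇ = record
  { X  = I 6 0 ∷ O 1 0 ∷ I 2 0 ∷ O 1 0 ∷ I 1 0 ∷ []
  ; Y  = I 5 0 ∷ O 1 0 ∷ I 3 0 ∷ []
  ; X² = I 1 0 ∷ O 6 0 ∷ I 1 0 ∷ O 2 0 ∷ I 1 0 ∷ O 5 0 ∷ I 1 0 ∷ O 4 0 ∷ I 1 0 ∷ []
  ; Y² = I 1 0 ∷ O 5 0 ∷ I 1 0 ∷ O 8 0 ∷ I 3 0 ∷ []
  ; XY = I 1 0 ∷ O 4 0 ∷ I 2 0 ∷ O 7 0 ∷ I 2 0 ∷ O 1 0 ∷ I 1 0 ∷ O 1 0 ∷ I 1 0 ∷ []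
  ; X-starts = tt ; Y-starts = tt
  ; X²-product = refl ; Y²-product = refl ; XY-product = refl
  ; constant-balanced = refl ; slope-balanced = refl
  }

pair₁₈ : BalancedFamily
pair₁₈ = record
  { X  = I 6 0 ∷ O 1 0 ∷ I 3 0 ∷ []
  ; Y  = I 6 0 ∷ O 1 0 ∷ I 3 0 ∷ []
  ; X² = I 1 0 ∷ O 6 0 ∷ I 1 0 ∷ O 3 0 ∷ I 1 0 ∷ O 5 0 ∷ I 3 0 ∷ []
  ; Y² = I 1 0 ∷ O 6 0 ∷ I 1 0 ∷ O 3 0 ∷ I 1 0 ∷ O 5 0 ∷ I 3 0 ∷ []
  ; XY = I 1 0 ∷ O 6 0 ∷ I 1 0 ∷ O 3 0 ∷ I 1 0 ∷ O 5 0 ∷ I 3 0 ∷ []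
  ; X-starts = tt ; Y-starts = tt
  ; X²-product = refl ; Y²-product = refl ; XY-product = refl
  ; constant-balanced = refl ; slope-balanced = refl
  }

pair₂₁ : BalancedFamily
pair₂₁ = record
  { X  = I 7 0 ∷ O 1 0 ∷ I 4 0 ∷ []
  ; Y  = I 6 0 ∷ O 1 0 ∷ I 4 0 ∷ []
  ; X² = I 1 0 ∷ O 7 0 ∷ I 1 0 ∷ O 4 0 ∷ I 1 0 ∷ O 6 0 ∷ I 4 0 ∷ []
  ; Y² = I 1 0 ∷ O 6 0 ∷ I 1 0 ∷ O 10 0 ∷ I 4 0 ∷ []
  ; XY = I 1 0 ∷ O 5 0 ∷ I 2 0 ∷ O 3 0 ∷ I 1 0 ∷ O 7 0 ∷ I 4 0 ∷ []
  ; X-starts = tt ; Y-starts = tt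
  ; X²-product = refl ; Y²-product = refl ; XY-product = refl
  ; constant-balanced = refl ; slope-balanced = refl
  }

-- Digit sums 16 + t + 3q with t < 3: the three families, plus the
-- sporadic values 17, 18 and 21 below their ranges.
by-residue : ∀ q t → t < 3 → Infinite (Solutions (16 + (t + q * 3)))
by-residue q             0 _ = subst (λ c → Infinite (Solutions (16 + c))) (*-comm 3 q) (family-solutions family₀ q)
by-residue zero          1 _ = family-solutions pair₁₇ 0
by-residue (suc q)       1 _ = subst (λ c → Infinite (Solutions (20 + c))) (*-comm 3 q) (family-solutions family₁ q)
by-residue zero          2 _ = family-solutions pair₁₈ 0
by-residue (suc zero)    2 _ = family-solutions pair₂₁ 0
by-residue (suc (suc q)) 2 _ = subst (λ c → Infinite (Solutions (24 + c))) (*-comm 3 q) (family-solutions family₂ q)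
by-residue q (suc (suc (suc t))) (s≤s (s≤s (s≤s ())))

at-least-16 : ∀ d → Infinite (Solutions (16 + d))
at-least-16 d = subst (λ c → Infinite (Solutions (16 + c))) (sym (m≡m%n+[m/n]*n d 3))
                      (by-residue (d / 3) (d % 3) (m%n<n d 3))

theorem1p4 : (k : ℕ) → (16 ≤ k ⊎ (k ≡ 12 ⊎ k ≡ 13)) →
    Infinite (λ n → 0 < n × Odd n × s₂ (n * n) ≡ k × s₂ n ≡ k)
theorem1p4 k   (inj₁ 16≤k)         = subst (λ c → Infinite (Solutions c)) (m+[n∸m]≡n 16≤k) (at-least-16 (k ∸ 16))
theorem1p4 .12 (inj₂ (inj₁ refl)) = family-solutions pair₁₂ 0
theorem1p4 .13 (inj₂ (inj₂ refl)) = family-solutions pair₁₃ 0
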